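{- Let $n \ge 3$ and let $R$ be a path orientation of $P_n$ (vertices $v_1,\dots,v_n$, edges $e_i=v_iv_{i+1}$). Then $R$ is a $p_2$-orientation if and only if all of the following hold: (a) no two adjacent edges of $R$ are both flat; (b) no flat edge of $R$ is incident with a leaf (i.e. $e_1$ and $e_{n-1}$ are not flat); (c) no flat edge of $R$ is adjacent to two edges that agree (i.e. there is no flat $e_i$ with $e_{i-1},e_{i+1}$ both right edges or both left edges); (d) whenever two adjacent edges $e_j,e_{j+1}$ are directed and agree (both right or both left), both edges $e_{j-1}$ and $e_{j+2}$ exist (i.e. $2\le j$ and $j+2\le n-1$) and each of them is directed and disagrees with $e_j$ (so the five consecutive vertices $v_{j+3},v_{j+2},v_{j+1},v_j,v_{j-1}$ read left to right carry the pattern left, right, right, left or right, left, left, right).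
   Context: Parallel Diffusion on a finite simple graph $G$: a configuration assigns an integer stack size $|v|$ (possibly negative) to each vertex $v$. In one step all vertices fire simultaneously: each vertex sends one chip to each neighbour with strictly smaller stack size, so the new stack size of $v$ is $|v| + \#\{u\sim v: |u|>|v|\} - \#\{u \sim v : |u|<|v|\}$. Starting from $C_0$, $C_{t+1}$ is obtained from $C_t$ by one step. A configuration $D$ is a $p_2$-configuration if there are a configuration $C_0$ and $N$ such that $C_{t+2}=C_t$ and $C_{t+1}\neq C_t$ for all $t\ge N$, and $D=C_t$ for some $t\ge N$ (equivalently, starting from $D$ one has $D_2=D\ne D_1$). The path $P_n$ has vertices $v_1,\dots,v_n$ and edges $e_i=v_iv_{i+1}$ ($1\le i\le n-1$), drawn horizontally with $v_1$ rightmost and $v_n$ leftmost; edges $e_i,e_{i+1}$ are adjacent. A path orientation assigns to each edge either "flat" or a direction. A directed edge $e_i$ is a right edge if directed $v_{i+1}\to v_i$ (head to the right of the tail) and a left edge if directed $v_i\to v_{i+1}$. Two directed edges agree if both are right or both are left, and disagree otherwise. A configuration induces the path orientation in which each edge is directed from the endpoint with larger stack size to the endpoint with smaller stack size, and is flat if the stack sizes are equal. A $p_2$-orientation is a path orientation induced by some $p_2$-configuration. -}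

module Defs where

open import Data.Nat using (ℕ; zero; suc; _≤_)
open import Data.Integer as ℤ using (ℤ; _+_; _-_; +_; _<?_)
open import Data.Fin using (Fin; toℕ; inject₁) renaming (suc to fsuc)
open import Data.List using (List; filter; length)
open import Data.List.Base using ()
open import Data.Fin.Base using ()
open import Data.List using () renaming (map to lmap)
open import Data.Vec.Functional using ()
open import Data.Product using (Σ; _×_; ∃; ∃-syntax)
open import Data.Sum using (_⊎_)
open import Data.Bool using (Bool; true; false; _∧_; _∨_)
open import Data.Bool.Properties using (∨-comm)
open import Data.Nat using (_≡ᵇ_)
open import Relation.Nullary using (¬_; yes; no)
open import Relation.Nullary.Decidable using (⌊_⌋)
open import Relation.Binary.PropositionalEquality using (_≡_; refl)
import Data.List as L

record Graph (n : ℕ) : Set where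
  field
    adj   : Fin n → Fin n → Bool
    sym   : ∀ u v → adj u v ≡ adj v u
    irrefl : ∀ v → adj v v ≡ false

open Graph public

Config : ℕ → Set
Config n = Fin n → ℤ

allV : (n : ℕ) → List (Fin n)
allV n = L.allFin n

#bigger : ∀ {n} → Graph n → Config n → Fin n → ℕ
#bigger {n} G C v = length (filter (λ u → (adj G u v ∧ ⌊ C v <? C u ⌋) Data.Bool.≟ true) (allV n))

#smaller : ∀ {n} → Graph n → Config n → Fin n → ℕ
#smaller {n} G C v = length (filter (λ u → (adj G u v ∧ ⌊ C u <? C v ⌋) Data.Bool.≟ true) (allV n))

step : ∀ {n} → Graph n → Config n → Config n
step G C v = C v + + (#bigger G C v) - + (#smaller G C v)

iter : ∀ {n} → Graph n → Config n → ℕ → Config n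
iter G C zero = C
iter G C (suc t) = step G (iter G C t)

_≈C_ : ∀ {n} → Config n → Config n → Set
C ≈C D = ∀ v → C v ≡ D v

IsP2Config : ∀ {n} → Graph n → Config n → Set
IsP2Config G D =
  Σ (Config _) λ C₀ → Σ ℕ λ N →
    (∀ t → N ≤ t → (iter G C₀ (suc (suc t)) ≈C iter G C₀ t)
                 × ¬ (iter G C₀ (suc t) ≈C iter G C₀ t))
    × (Σ ℕ λ t → N ≤ t × (D ≈C iter G C₀ t))

-- The path P_n with n = suc m vertices.  Vertex k : Fin (suc m) is v_{k+1};
-- edge i : Fin m is e_{i+1} = v_{i+1} v_{i+2}, i.e. joins inject₁ i and fsuc i.

adjℕ : ℕ → ℕ → Bool
adjℕ a b = (suc a ≡ᵇ b) ∨ (suc b ≡ᵇ a)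

private
  suc≢ᵇ : ∀ a → (suc a ≡ᵇ a) ≡ false
  suc≢ᵇ zero = refl
  suc≢ᵇ (suc a) = suc≢ᵇ a

  adjℕ-irrefl : ∀ a → adjℕ a a ≡ false
  adjℕ-irrefl a rewrite suc≢ᵇ a = refl

  adjℕ-sym : ∀ a b → adjℕ a b ≡ adjℕ b a
  adjℕ-sym a b = ∨-comm (suc a ≡ᵇ b) (suc b ≡ᵇ a)

Path : (m : ℕ) → Graph (suc m)
Path m = record
  { adj = λ u v → adjℕ (toℕ u) (toℕ v)
  ; sym = λ u v → adjℕ-sym (toℕ u) (toℕ v)
  ; irrefl = λ v → adjℕ-irrefl (toℕ v)
  }

data EdgeOri : Set where
  flat right left : EdgeOri

PathOrientation : ℕ → Set
PathOrientation m = Fin m → EdgeOri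

-- induced orientation: edge e (joining v = inject₁ e and v' = fsuc e);
-- right edge iff |v'| > |v| (directed v' → v), left edge iff |v| > |v'|.
orient : ℤ → ℤ → EdgeOri
orient a b with a <? b | b <? a
... | yes _ | _     = right
... | no _  | yes _ = left
... | no _  | no _  = flat

induced : ∀ {m} → Config (suc m) → PathOrientation m
induced C e = orient (C (inject₁ e)) (C (fsuc e))

IsP2Orientation : ∀ {m} → PathOrientation m → Set
IsP2Orientation {m} R =
  Σ (Config (suc m)) λ D → IsP2Config (Path m) D × (∀ e → induced D e ≡ R e)

Agree : EdgeOri → EdgeOri → Set
Agree x y = (x ≡ right × y ≡ right) ⊎ (x ≡ left × y ≡ left)

Disagree : EdgeOri → EdgeOri → Set
Disagree x y = (x ≡ right × y ≡ left) ⊎ (x ≡ left × y ≡ right)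

Next : ∀ {m} → Fin m → Fin m → Set
Next i j = toℕ j ≡ suc (toℕ i)

CondA : ∀ {m} → PathOrientation m → Set
CondA {m} R = ∀ (i j : Fin m) → Next i j → ¬ (R i ≡ flat × R j ≡ flat)

CondB : ∀ {m} → PathOrientation m → Set
CondB {m} R = ∀ (i : Fin m) → R i ≡ flat → ¬ (toℕ i ≡ 0) × ¬ (suc (toℕ i) ≡ m)

CondC : ∀ {m} → PathOrientation m → Set
CondC {m} R = ∀ (h i j : Fin m) → Next h i → Next i j → R i ≡ flat → ¬ Agree (R h) (R j)

CondD : ∀ {m} → PathOrientation m → Set
CondD {m} R = ∀ (j k : Fin m) → Next j k → Agree (R j) (R k) →
  Σ (Fin m) λ h → Σ (Fin m) λ l →
    Next h j × Next k l × Disagree (R h) (R j) × Disagree (R l) (R j)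

-- Write s_k ∈ {1, 0, -1} for the sign of |v_{k+1}| - |v_k|, the slope of e_k (and s = 0 beyond
-- the leaves).  One step adds s_k - s_{k-1} to |v_k|, so a configuration returns after two steps
-- iff every slope changes sign in the first step.  Whether e_k reverses depends only on s_{k-1},
-- s_k, s_{k+1} and on the height difference across e_k, and a difference beyond ±1 only makes
-- reversal harder.  Hence R is a p2-orientation iff it is not flat everywhere and every edge
-- reverses in the configuration whose stack sizes are the partial sums of the slopes of R.  Away
-- from the everywhere-flat orientation, this local reversal condition is exactly (a)–(d) at each edge.
module Submission where

open import Defs hiding (sym)
open import Data.Bool using (Bool; true; false; T; _∧_; if_then_else_; _≟_)
open import Data.Empty using (⊥-elim)
open import Data.Fin using (Fin; toℕ; inject₁; fromℕ<) renaming (zero to fzero; suc to fsuc)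
open import Data.Fin.Properties using (toℕ-inject₁; toℕ-fromℕ<; toℕ<n; toℕ-injective)
open import Data.Integer as ℤ using (ℤ; +_; -[1+_]; _+_; _-_; -_; _<?_; 0ℤ; pred)
import Data.Integer.Properties as ℤ
open import Data.Integer.Solver using (module +-*-Solver)
open import Data.List using (filter; length; tabulate; allFin)
open import Data.List.Properties using (filter-≐)
open import Data.Nat as ℕ using (ℕ; zero; suc; z≤n; s≤s; _≤_; _<_)
import Data.Nat.Properties as ℕ
open import Data.Product using (Σ-syntax; _×_; _,_; proj₁; proj₂)
open import Data.Sum using (inj₁; inj₂)
open import Data.Unit using (tt)
open import Function using (_∘_; id)
open import Function.Bundles using (_⇔_; mk⇔; Equivalence)
open import Function.Properties.Equivalence using (⇔-setoid)
open import Level using (0ℓ)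
open import Relation.Binary using (tri<; tri≈; tri>)
open import Relation.Binary.PropositionalEquality
import Relation.Binary.Reasoning.Setoid as SetoidReasoning
open import Relation.Nullary using (¬_; yes; no)
open import Relation.Nullary.Decidable using (⌊_⌋)

open +-*-Solver

sgn : EdgeOri → ℤ
sgn right = + 1
sgn left  = -[1+ 0 ]
sgn flat  = + 0

opposite : EdgeOri → EdgeOri
opposite right = left
opposite left  = right
opposite flat  = flat

sgn-opposite : ∀ o → sgn (opposite o) ≡ - sgn o
sgn-opposite right = refl
sgn-opposite left  = refl
sgn-opposite flat  = refl

sgn-injective : ∀ {o o′} → sgn o ≡ sgn o′ → o ≡ o′
sgn-injective {right} {right} _ = refl
sgn-injective {left}  {left}  _ = refl
sgn-injective {flat}  {flat}  _ = refl
sgn-injective {right} {left}  ()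
sgn-injective {right} {flat}  ()
sgn-injective {left}  {right} ()
sgn-injective {left}  {flat}  ()
sgn-injective {flat}  {right} ()
sgn-injective {flat}  {left}  ()

opposite-fixed⇒flat : ∀ {o} → opposite o ≡ o → o ≡ flat
opposite-fixed⇒flat {flat} _ = refl

orient-< : ∀ {x y} → x ℤ.< y → orient x y ≡ right
orient-< {x} {y} x<y with x <? y
... | yes _   = refl
... | no  x≮y = ⊥-elim (x≮y x<y)

orient-> : ∀ {x y} → y ℤ.< x → orient x y ≡ left
orient-> {x} {y} y<x with x <? y | y <? x
... | yes x<y | _       = ⊥-elim (ℤ.<-asym x<y y<x)
... | no  _   | yes _   = refl
... | no  _   | no  y≮x = ⊥-elim (y≮x y<x)

orient-refl : ∀ x → orient x x ≡ flat
orient-refl x with x <? x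
... | yes x<x = ⊥-elim (ℤ.<-irrefl refl x<x)
... | no  _   = refl

orient≡right⇒< : ∀ {x y} → orient x y ≡ right → x ℤ.< y
orient≡right⇒< {x} {y} eq with x <? y | y <? x
orient≡right⇒< _  | yes x<y | _     = x<y
orient≡right⇒< () | no  _   | yes _
orient≡right⇒< () | no  _   | no  _

orient≡left⇒> : ∀ {x y} → orient x y ≡ left → y ℤ.< x
orient≡left⇒> {x} {y} eq with x <? y | y <? x
orient≡left⇒> () | yes _ | _
orient≡left⇒> _  | no  _ | yes y<x = y<x
orient≡left⇒> () | no  _ | no  _

orient-shift : ∀ c x y → orient (c + x) (c + y) ≡ orient x y
orient-shift c x y with ℤ.<-cmp x y
... | tri< x<y _ _  = trans (orient-< (ℤ.+-monoʳ-< c x<y)) (sym (orient-< x<y))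
... | tri≈ _ refl _ = trans (orient-refl (c + x)) (sym (orient-refl x))
... | tri> _ _ y<x  = trans (orient-> (ℤ.+-monoʳ-< c y<x)) (sym (orient-> y<x))

orient-sgn : ∀ x o → orient x (x + sgn o) ≡ o
orient-sgn x o = begin
  orient x (x + sgn o)         ≡⟨ cong (λ z → orient z (x + sgn o)) (sym (ℤ.+-identityʳ x)) ⟩
  orient (x + 0ℤ) (x + sgn o)  ≡⟨ orient-shift x 0ℤ (sgn o) ⟩
  orient 0ℤ (sgn o)            ≡⟨ from-zero o ⟩
  o                            ∎
  where
  open ≡-Reasoning
  from-zero : ∀ o → orient 0ℤ (sgn o) ≡ o
  from-zero right = refl
  from-zero left  = refl
  from-zero flat  = refl

indicator : Bool → ℕ
indicator true  = 1
indicator false = 0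

sgn-orient : ∀ x y → sgn (orient x y) ≡ + indicator ⌊ x <? y ⌋ - + indicator ⌊ y <? x ⌋
sgn-orient x y with x <? y | y <? x
... | yes x<y | yes y<x = ⊥-elim (ℤ.<-asym x<y y<x)
... | yes _   | no  _   = refl
... | no  _   | yes _   = refl
... | no  _   | no  _   = refl

-- Position k ≥ 1 holds the edge e_k; position 0 and the positions past m stand for the
-- missing edges beyond the two leaves and read as flat.
pad : ∀ {m} → PathOrientation m → ℕ → EdgeOri
pad         R zero          = flat
pad {zero}  R (suc k)       = flat
pad {suc m} R (suc zero)    = R fzero
pad {suc m} R (suc (suc k)) = pad (R ∘ fsuc) (suc k)

pad-suc-toℕ : ∀ {m} (R : PathOrientation m) i → pad R (suc (toℕ i)) ≡ R i
pad-suc-toℕ R fzero    = refl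
pad-suc-toℕ R (fsuc i) = pad-suc-toℕ (R ∘ fsuc) i

pad-beyond : ∀ {m} (R : PathOrientation m) {k} → m < k → pad R k ≡ flat
pad-beyond {zero}  R {suc k}       _               = refl
pad-beyond {suc m} R {suc (suc k)} (s≤s (s≤s m<k)) = pad-beyond (R ∘ fsuc) (s≤s m<k)

pad-cong : ∀ {m} {R R′ : PathOrientation m} → (∀ i → R i ≡ R′ i) → ∀ k → pad R k ≡ pad R′ k
pad-cong         R≡R′ zero          = refl
pad-cong {zero}  R≡R′ (suc k)       = refl
pad-cong {suc m} R≡R′ (suc zero)    = R≡R′ fzero
pad-cong {suc m} R≡R′ (suc (suc k)) = pad-cong (R≡R′ ∘ fsuc) (suc k)

pad-map : ∀ (f : EdgeOri → EdgeOri) → f flat ≡ flat →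
  ∀ {m} (R : PathOrientation m) k → pad (f ∘ R) k ≡ f (pad R k)
pad-map f f-flat         R zero          = sym f-flat
pad-map f f-flat {zero}  R (suc k)       = sym f-flat
pad-map f f-flat {suc m} R (suc zero)    = refl
pad-map f f-flat {suc m} R (suc (suc k)) = pad-map f f-flat (R ∘ fsuc) (suc k)

Flat : ∀ {m} → PathOrientation m → Set
Flat R = ∀ i → R i ≡ flat

AtEveryEdge : ∀ {m} → (EdgeOri → EdgeOri → EdgeOri → Set) → PathOrientation m → Set
AtEveryEdge P R = ∀ i → P (pad R (toℕ i)) (R i) (pad R (suc (suc (toℕ i))))

AtEveryEdge-cong : ∀ {m} {P} {R R′ : PathOrientation m} → (∀ i → R i ≡ R′ i) →
  AtEveryEdge P R → AtEveryEdge P R′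
AtEveryEdge-cong {P = P} {R} {R′} R≡R′ at i =
  subst₂ (λ p r → P p (R′ i) r) (pad-cong R≡R′ (toℕ i)) (pad-cong R≡R′ (suc (suc (toℕ i))))
    (subst (λ q → P (pad R (toℕ i)) q (pad R (suc (suc (toℕ i))))) (R≡R′ i) (at i))

at-position : ∀ {m} {P} {R : PathOrientation m} → AtEveryEdge P R →
  ∀ k → k < m → P (pad R k) (pad R (suc k)) (pad R (suc (suc k)))
at-position {P = P} {R} at k k<m =
  subst (λ j → P (pad R j) (pad R (suc j)) (pad R (suc (suc j)))) (toℕ-fromℕ< k<m)
    (subst (λ q → P (pad R (toℕ e)) q (pad R (suc (suc (toℕ e))))) (sym (pad-suc-toℕ R e)) (at e))
  where e = fromℕ< k<m

-- One step on the path

countBelow : ℕ → (ℕ → Bool) → ℕ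
countBelow zero    P = 0
countBelow (suc n) P = indicator (P 0) ℕ.+ countBelow n (P ∘ suc)

countBelow-false : ∀ n → countBelow n (λ _ → false) ≡ 0
countBelow-false zero    = refl
countBelow-false (suc n) = countBelow-false n

length-filter-tabulate : ∀ {A : Set} {n} (f : Fin n → A) (b : A → Bool) (P : ℕ → Bool) →
  (∀ i → b (f i) ≡ P (toℕ i)) → length (filter (λ a → b a ≟ true) (tabulate f)) ≡ countBelow n P
length-filter-tabulate {n = zero}  f b P b≡P = refl
length-filter-tabulate {n = suc n} f b P b≡P
  with b (f fzero) | P 0 | b≡P fzero
... | true  | .true  | refl = cong suc (length-filter-tabulate (f ∘ fsuc) b (P ∘ suc) (b≡P ∘ fsuc))
... | false | .false | refl = length-filter-tabulate (f ∘ fsuc) b (P ∘ suc) (b≡P ∘ fsuc)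

prevCount : (ℕ → Bool) → ℕ → ℕ
prevCount P zero    = 0
prevCount P (suc j) = indicator (P j)

nextCount : (ℕ → Bool) → ℕ → ℕ → ℕ
nextCount P k m = if k ℕ.<ᵇ m then indicator (P (suc k)) else 0

countBelow-adjacent : ∀ P k m → k ≤ m →
  countBelow (suc m) (λ x → adjℕ x k ∧ P x) ≡ prevCount P k ℕ.+ nextCount P k m
countBelow-adjacent P zero          zero    _         = refl
countBelow-adjacent P zero          (suc m) _         =
  trans (cong (indicator (P 1) ℕ.+_) (countBelow-false m)) (ℕ.+-identityʳ _)
countBelow-adjacent P (suc zero)    (suc m) (s≤s k≤m) =
  cong (indicator (P 0) ℕ.+_) (countBelow-adjacent (P ∘ suc) zero m k≤m)
countBelow-adjacent P (suc (suc k)) (suc m) (s≤s k≤m) = countBelow-adjacent (P ∘ suc) (suc k) m k≤m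

-- Indices beyond m are sent to the last vertex; only indices ≤ m are ever used.
clamp : ∀ m → ℕ → Fin (suc m)
clamp zero    k       = fzero
clamp (suc m) zero    = fzero
clamp (suc m) (suc k) = fsuc (clamp m k)

clamp-toℕ : ∀ m (u : Fin (suc m)) → clamp m (toℕ u) ≡ u
clamp-toℕ zero    fzero    = refl
clamp-toℕ (suc m) fzero    = refl
clamp-toℕ (suc m) (fsuc u) = cong fsuc (clamp-toℕ m u)

extend : ∀ {m} → Config (suc m) → ℕ → ℤ
extend {m} C = C ∘ clamp m

extend-toℕ : ∀ {m} (C : Config (suc m)) u → C u ≡ extend C (toℕ u)
extend-toℕ {m} C u = cong C (sym (clamp-toℕ m u))

count-path-neighbours : ∀ {m} (C : Config (suc m)) v (cmp : ℤ → ℤ → Bool) →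
  let k = toℕ v; P = λ x → cmp (extend C k) (extend C x) in
  length (filter (λ u → (adjℕ (toℕ u) k ∧ cmp (C v) (C u)) ≟ true) (allFin (suc m)))
    ≡ prevCount P k ℕ.+ nextCount P k m
count-path-neighbours {m} C v cmp =
  trans (length-filter-tabulate id _ P λ u →
           cong₂ (λ a b → adjℕ (toℕ u) (toℕ v) ∧ cmp a b) (extend-toℕ C v) (extend-toℕ C u))
        (countBelow-adjacent _ (toℕ v) m (ℕ.s≤s⁻¹ (toℕ<n v)))
  where
  P : ℕ → Bool
  P x = adjℕ x (toℕ v) ∧ cmp (extend C (toℕ v)) (extend C x)

pad-induced : ∀ {m} (C : Config (suc m)) j → j < m →
  pad (induced C) (suc j) ≡ orient (extend C j) (extend C (suc j))
pad-induced C j j<m = begin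
  pad (induced C) (suc j)              ≡⟨ cong (pad (induced C) ∘ suc) (sym (toℕ-fromℕ< j<m)) ⟩
  pad (induced C) (suc (toℕ e))        ≡⟨ pad-suc-toℕ (induced C) e ⟩
  orient (C (inject₁ e)) (C (fsuc e))  ≡⟨ cong₂ orient
    (trans (extend-toℕ C (inject₁ e)) (cong (extend C) (trans (toℕ-inject₁ e) (toℕ-fromℕ< j<m))))
    (trans (extend-toℕ C (fsuc e)) (cong (extend C ∘ suc) (toℕ-fromℕ< j<m))) ⟩
  orient (extend C j) (extend C (suc j)) ∎
  where
  open ≡-Reasoning
  e = fromℕ< j<m

slope : ∀ {m} → Config (suc m) → ℕ → ℤ
slope C k = sgn (pad (induced C) k)

prevCount-slope : ∀ {m} (C : Config (suc m)) k → k ≤ m → let c = extend C in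
  + prevCount (λ x → ⌊ c x <? c k ⌋) k - + prevCount (λ x → ⌊ c k <? c x ⌋) k ≡ slope C k
prevCount-slope C zero    _   = refl
prevCount-slope C (suc j) j<m =
  trans (sym (sgn-orient (extend C j) (extend C (suc j)))) (cong sgn (sym (pad-induced C j j<m)))

nextCount-slope : ∀ {m} (C : Config (suc m)) k → let c = extend C in
  + nextCount (λ x → ⌊ c k <? c x ⌋) k m - + nextCount (λ x → ⌊ c x <? c k ⌋) k m ≡ slope C (suc k)
nextCount-slope {m} C k with k ℕ.<ᵇ m in k<ᵇm
... | true  = trans (sym (sgn-orient (extend C k) (extend C (suc k))))
                    (cong sgn (sym (pad-induced C k (ℕ.<ᵇ⇒< k m (subst T (sym k<ᵇm) tt)))))
... | false = cong sgn (sym (pad-beyond (induced C) (s≤s (ℕ.≮⇒≥ λ k<m → subst T k<ᵇm (ℕ.<⇒<ᵇ k<m)))))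

step-path : ∀ {m} (C : Config (suc m)) v →
  step (Path m) C v ≡ C v + (slope C (suc (toℕ v)) - slope C (toℕ v))
step-path {m} C v = begin
  C v + + #bigger (Path m) C v - + #smaller (Path m) C v
    ≡⟨ cong₂ (λ a b → C v + + a - + b) (count-path-neighbours C v (λ a b → ⌊ a <? b ⌋))
                                        (count-path-neighbours C v (λ a b → ⌊ b <? a ⌋)) ⟩
  C v + + (prevHigher ℕ.+ nextHigher) - + (prevLower ℕ.+ nextLower)
    ≡⟨ regroup (C v) prevHigher nextHigher prevLower nextLower ⟩
  C v + ((+ nextHigher - + nextLower) - (+ prevLower - + prevHigher))
    ≡⟨ cong₂ (λ a b → C v + (a - b)) (nextCount-slope C k) (prevCount-slope C k (ℕ.s≤s⁻¹ (toℕ<n v))) ⟩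
  C v + (slope C (suc k) - slope C k) ∎
  where
  open ≡-Reasoning
  k = toℕ v
  higher lower : ℕ → Bool
  higher x = ⌊ extend C k <? extend C x ⌋
  lower  x = ⌊ extend C x <? extend C k ⌋
  prevHigher nextHigher prevLower nextLower : ℕ
  prevHigher = prevCount higher k
  nextHigher = nextCount higher k m
  prevLower  = prevCount lower k
  nextLower  = nextCount lower k m
  regroup : ∀ c a b d e → c + + (a ℕ.+ b) - + (d ℕ.+ e) ≡ c + ((+ b - + e) - (+ d - + a))
  regroup c a b d e = trans (cong₂ (λ x y → c + x - y) (ℤ.pos-+ a b) (ℤ.pos-+ d e))
    (solve 5 (λ c a b d e → c :+ (a :+ b) :- (d :+ e) := c :+ ((b :- e) :- (d :- a))) refl
           c (+ a) (+ b) (+ d) (+ e))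

-- Period two

length-filter-cong : ∀ {n} {b b′ : Fin n → Bool} → (∀ u → b u ≡ b′ u) → ∀ xs →
  length (filter (λ u → b u ≟ true) xs) ≡ length (filter (λ u → b′ u ≟ true) xs)
length-filter-cong b≡b′ xs =
  cong length (filter-≐ _ _ ((λ {u} → trans (sym (b≡b′ u))) , (λ {u} → trans (b≡b′ u))) xs)

step-cong : ∀ {n} (G : Graph n) {C C′ : Config n} → C ≈C C′ → step G C ≈C step G C′
step-cong {n} G {C} {C′} C≈C′ v =
  trans (cong (λ x → x + + #bigger G C v - + #smaller G C v) (C≈C′ v))
        (cong₂ (λ a b → C′ v + + a - + b) (same-count λ x y → ⌊ x <? y ⌋) (same-count λ x y → ⌊ y <? x ⌋))
  where
  same-count : ∀ (cmp : ℤ → ℤ → Bool) →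
    length (filter (λ u → (adj G u v ∧ cmp (C v) (C u)) ≟ true) (allV n))
      ≡ length (filter (λ u → (adj G u v ∧ cmp (C′ v) (C′ u)) ≟ true) (allV n))
  same-count cmp = length-filter-cong (λ u → cong₂ (λ x y → adj G u v ∧ cmp x y) (C≈C′ v) (C≈C′ u)) (allV n)

isP2Config⇔ : ∀ {n} (G : Graph n) (D : Config n) →
  IsP2Config G D ⇔ (step G (step G D) ≈C D × ¬ (step G D ≈C D))
isP2Config⇔ G D = mk⇔ to from
  where
  to : IsP2Config G D → step G (step G D) ≈C D × ¬ (step G D ≈C D)
  to (_ , _ , periodic , t , N≤t , D≈Cₜ) =
    (λ v → trans (step-cong G (step-cong G D≈Cₜ) v) (trans (period v) (sym (D≈Cₜ v)))) ,
    (λ fixed → moving λ v → trans (sym (step-cong G D≈Cₜ v)) (trans (fixed v) (D≈Cₜ v)))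
    where
    period = proj₁ (periodic t N≤t)
    moving = proj₂ (periodic t N≤t)
  from : step G (step G D) ≈C D × ¬ (step G D ≈C D) → IsP2Config G D
  from (two , moving) = D , 0 , (λ t _ → period t , nonfixed t) , 0 , z≤n , (λ _ → refl)
    where
    period : ∀ t → iter G D (suc (suc t)) ≈C iter G D t
    period zero    = two
    period (suc t) = step-cong G (period t)
    nonfixed : ∀ t → ¬ (iter G D (suc t) ≈C iter G D t)
    nonfixed zero          = moving
    nonfixed (suc t) fixed = nonfixed t λ v → trans (sym (fixed v)) (period t v)

i+j+k≡i⇒k≡-j : ∀ i j k → i + j + k ≡ i → k ≡ - j
i+j+k≡i⇒k≡-j i j k eq = begin
  k                  ≡⟨ solve 3 (λ i j k → k := ((i :+ j) :+ k) :- i :- j) refl i j k ⟩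
  (i + j + k) - i - j ≡⟨ cong (λ z → z - i - j) eq ⟩
  i - i - j          ≡⟨ solve 2 (λ i j → i :- i :- j := :- j) refl i j ⟩
  - j                ∎
  where open ≡-Reasoning

i-j≡-[k-l]⇒j≡-l⇒i≡-k : ∀ i j k l → i - j ≡ - (k - l) → j ≡ - l → i ≡ - k
i-j≡-[k-l]⇒j≡-l⇒i≡-k i j k l eq j≡-l = begin
  i                ≡⟨ solve 2 (λ i j → i := (i :- j) :+ j) refl i j ⟩
  (i - j) + j      ≡⟨ cong₂ _+_ eq j≡-l ⟩
  - (k - l) + - l  ≡⟨ solve 2 (λ k l → :- (k :- l) :+ :- l := :- k) refl k l ⟩
  - k              ∎
  where open ≡-Reasoning

module _ {m : ℕ} (D : Config (suc m)) where

  private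
    E = step (Path m) D

  -- Comparing step-path for D and for E at a vertex shows that its slope differences are
  -- negated; telescoping from the flat position 0 gives the claim.
  period-two⇒slopes : step (Path m) E ≈C D → ∀ k → k ≤ m → slope E k ≡ - slope D k
  period-two⇒slopes two zero    _   = refl
  period-two⇒slopes two (suc k) k<m = i-j≡-[k-l]⇒j≡-l⇒i≡-k _ _ _ _
    (subst (λ j → slope E (suc j) - slope E j ≡ - (slope D (suc j) - slope D j))
           (toℕ-fromℕ< (s≤s (ℕ.<⇒≤ k<m))) (balance _))
    (period-two⇒slopes two k (ℕ.<⇒≤ k<m))
    where
    balance : ∀ v → slope E (suc (toℕ v)) - slope E (toℕ v)
                   ≡ - (slope D (suc (toℕ v)) - slope D (toℕ v))
    balance v = i+j+k≡i⇒k≡-j (D v) _ _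
      (trans (cong (_+ (slope E (suc (toℕ v)) - slope E (toℕ v))) (sym (step-path D v)))
             (trans (sym (step-path E v)) (two v)))

  reversing⇒slopes : (∀ e → induced E e ≡ opposite (induced D e)) → ∀ k → slope E k ≡ - slope D k
  reversing⇒slopes reversing k = begin
    sgn (pad (induced E) k)             ≡⟨ cong sgn (pad-cong reversing k) ⟩
    sgn (pad (opposite ∘ induced D) k)  ≡⟨ cong sgn (pad-map opposite refl (induced D) k) ⟩
    sgn (opposite (pad (induced D) k))  ≡⟨ sgn-opposite _ ⟩
    - slope D k                         ∎
    where open ≡-Reasoning

  period-two⇔reversing : step (Path m) E ≈C D ⇔ (∀ e → induced E e ≡ opposite (induced D e))
  period-two⇔reversing = mk⇔ to from
    where
    open ≡-Reasoning
    to : step (Path m) E ≈C D → ∀ e → induced E e ≡ opposite (induced D e)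
    to two e = sgn-injective (begin
      sgn (induced E e)             ≡⟨ cong sgn (sym (pad-suc-toℕ (induced E) e)) ⟩
      slope E (suc (toℕ e))         ≡⟨ period-two⇒slopes two (suc (toℕ e)) (toℕ<n e) ⟩
      - slope D (suc (toℕ e))       ≡⟨ cong (-_ ∘ sgn) (pad-suc-toℕ (induced D) e) ⟩
      - sgn (induced D e)           ≡⟨ sym (sgn-opposite _) ⟩
      sgn (opposite (induced D e))  ∎)
    from : (∀ e → induced E e ≡ opposite (induced D e)) → step (Path m) E ≈C D
    from reversing v = begin
      step (Path m) E v                    ≡⟨ step-path E v ⟩
      E v + (slope E (suc k) - slope E k)  ≡⟨ cong₂ _+_ (step-path D v)
                                                (cong₂ _-_ (reversing⇒slopes reversing (suc k))
                                                           (reversing⇒slopes reversing k)) ⟩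
      D v + (slope D (suc k) - slope D k) + (- slope D (suc k) - - slope D k)
        ≡⟨ solve 3 (λ x a b → x :+ (a :- b) :+ (:- a :- :- b) := x) refl
                   (D v) (slope D (suc k)) (slope D k) ⟩
      D v                                  ∎
      where k = toℕ v

  flat⇒fixed : (∀ e → induced D e ≡ flat) → E ≈C D
  flat⇒fixed all-flat v = trans (step-path D v) (trans
    (cong₂ (λ a b → D v + (a - b)) (level (suc (toℕ v))) (level (toℕ v))) (ℤ.+-identityʳ (D v)))
    where
    level : ∀ k → slope D k ≡ 0ℤ
    level k = cong sgn (trans (pad-cong all-flat k) (pad-map (λ _ → flat) refl (induced D) k))

  induced-step : ∀ e → let R = induced D; k = toℕ e in
    induced E e ≡ orient (D (inject₁ e) + (sgn (R e) - sgn (pad R k)))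
                         (D (fsuc e) + (sgn (pad R (suc (suc k))) - sgn (R e)))
  induced-step e = cong₂ orient
    (trans (step-path D (inject₁ e))
      (trans (cong (λ j → D (inject₁ e) + (slope D (suc j) - slope D j)) (toℕ-inject₁ e))
             (cong (λ o → D (inject₁ e) + (sgn o - slope D (toℕ e))) (pad-suc-toℕ (induced D) e))))
    (trans (step-path D (fsuc e))
      (cong (λ o → D (fsuc e) + (slope D (suc (suc (toℕ e))) - sgn o)) (pad-suc-toℕ (induced D) e)))

-- When a single edge reverses

-- By orient-after-step, this says that the middle edge q reverses in one step when the two
-- stack sizes it joins differ by exactly sgn q (see unit-reversal).
Reverses : EdgeOri → EdgeOri → EdgeOri → Set
Reverses p q r = orient (sgn q) (sgn p + sgn r) ≡ opposite q

orient-after-step : ∀ x y a b c →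
  orient (x + (b - a)) (y + (c - b)) ≡ orient b ((a + c) + (y - (b + x)))
orient-after-step x y a b c = trans
  (cong₂ orient
    (solve 3 (λ x a b → x :+ (b :- a) := (x :- a) :+ b) refl x a b)
    (solve 5 (λ x y a b c → y :+ (c :- b) := (x :- a) :+ ((a :+ c) :+ (y :- (b :+ x)))) refl x y a b c))
  (orient-shift (x - a) b _)

-- An edge steeper than a unit step is only harder to reverse.
drop-excess : ∀ x y s → let q = orient x y in
  orient (sgn q) (s + (y - (sgn q + x))) ≡ opposite q → orient (sgn q) s ≡ opposite q
drop-excess x y s with ℤ.<-cmp x y
... | tri< x<y _ _ rewrite orient-< x<y = λ reversed → orient->
  (ℤ.≤-<-trans (ℤ.i≤i+j s _ {{ℤ.nonNegative (ℤ.i≤j⇒0≤j-i (ℤ.i<j⇒suc[i]≤j x<y))}})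
               (orient≡left⇒> reversed))
... | tri≈ _ refl _ rewrite orient-refl x =
  subst (λ z → orient 0ℤ z ≡ flat) (solve 2 (λ s x → s :+ (x :- (con 0ℤ :+ x)) := s) refl s x)
... | tri> _ _ y<x rewrite orient-> y<x = λ reversed → orient-<
  (ℤ.<-≤-trans (orient≡right⇒< reversed)
               (subst (s + _ ℤ.≤_) (ℤ.+-identityʳ s) (ℤ.+-monoʳ-≤ s (ℤ.i≤j⇒i-j≤0 y≤pred-x))))
  where
  y≤pred-x : y ℤ.≤ pred x
  y≤pred-x = subst (ℤ._≤ pred x) (ℤ.pred-suc y) (ℤ.pred-mono (ℤ.i<j⇒suc[i]≤j y<x))

reversal⇒reverses : ∀ x y p r → let q = orient x y in
  orient (x + (sgn q - sgn p)) (y + (sgn r - sgn q)) ≡ opposite q → Reverses p q r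
reversal⇒reverses x y p r reversed =
  drop-excess x y _ (trans (sym (orient-after-step x y (sgn p) _ (sgn r))) reversed)

unit-reversal : ∀ x p q r → Reverses p q r →
  orient (x + (sgn q - sgn p)) ((x + sgn q) + (sgn r - sgn q)) ≡ opposite q
unit-reversal x p q r reverses = begin
  orient (x + (sgn q - sgn p)) ((x + sgn q) + (sgn r - sgn q))
    ≡⟨ orient-after-step x (x + sgn q) (sgn p) (sgn q) (sgn r) ⟩
  orient (sgn q) ((sgn p + sgn r) + ((x + sgn q) - (sgn q + x)))
    ≡⟨ cong (orient (sgn q))
            (solve 3 (λ s x b → s :+ ((x :+ b) :- (b :+ x)) := s) refl (sgn p + sgn r) x (sgn q)) ⟩
  orient (sgn q) (sgn p + sgn r)
    ≡⟨ reverses ⟩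
  opposite q
    ∎
  where open ≡-Reasoning

reversing⇒reverses : ∀ {m} (D : Config (suc m)) →
  (∀ e → induced (step (Path m) D) e ≡ opposite (induced D e)) → AtEveryEdge Reverses (induced D)
reversing⇒reverses D reversing e =
  reversal⇒reverses (D (inject₁ e)) (D (fsuc e)) (pad (induced D) (toℕ e))
    (pad (induced D) (suc (suc (toℕ e)))) (trans (sym (induced-step D e)) (reversing e))

unit-steps⇒reversing : ∀ {m} (D : Config (suc m)) →
  (∀ e → D (fsuc e) ≡ D (inject₁ e) + sgn (induced D e)) → AtEveryEdge Reverses (induced D) →
  ∀ e → induced (step (Path m) D) e ≡ opposite (induced D e)
unit-steps⇒reversing D unit reverses e = trans (induced-step D e)
  (trans (cong (λ y → orient (x + (sgn q - sgn p)) (y + (sgn r - sgn q))) (unit e))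
         (unit-reversal x p q r (reverses e)))
  where
  x = D (inject₁ e)
  p = pad (induced D) (toℕ e)
  q = induced D e
  r = pad (induced D) (suc (suc (toℕ e)))

height : ∀ {m} → PathOrientation m → ℕ → ℤ
height R zero    = 0ℤ
height R (suc k) = height R k + sgn (pad R (suc k))

heights : ∀ {m} → PathOrientation m → Config (suc m)
heights R u = height R (toℕ u)

induced-heights : ∀ {m} (R : PathOrientation m) e → induced (heights R) e ≡ R e
induced-heights R e = begin
  orient (height R (toℕ (inject₁ e))) (height R (suc (toℕ e)))
    ≡⟨ cong (λ k → orient (height R k) (height R (suc (toℕ e)))) (toℕ-inject₁ e) ⟩
  orient (height R (toℕ e)) (height R (toℕ e) + sgn (pad R (suc (toℕ e))))
    ≡⟨ orient-sgn (height R (toℕ e)) (pad R (suc (toℕ e))) ⟩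
  pad R (suc (toℕ e))
    ≡⟨ pad-suc-toℕ R e ⟩
  R e
    ∎
  where open ≡-Reasoning

heights-unit-steps : ∀ {m} (R : PathOrientation m) e →
  heights R (fsuc e) ≡ heights R (inject₁ e) + sgn (induced (heights R) e)
heights-unit-steps R e = cong₂ _+_ (cong (height R) (sym (toℕ-inject₁ e)))
                                   (cong sgn (trans (pad-suc-toℕ R e) (sym (induced-heights R e))))

p2-orientation⇔ : ∀ {m} (R : PathOrientation m) →
  IsP2Orientation R ⇔ (AtEveryEdge Reverses R × ¬ Flat R)
p2-orientation⇔ {m} R = mk⇔ to from
  where
  to : IsP2Orientation R → AtEveryEdge Reverses R × ¬ Flat R
  to (D , p2 , D↦R) with Equivalence.to (isP2Config⇔ (Path m) D) p2
  ... | two , moving =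
    AtEveryEdge-cong {P = Reverses} D↦R
      (reversing⇒reverses D (Equivalence.to (period-two⇔reversing D) two)) ,
    λ all-flat → moving (flat⇒fixed D λ e → trans (D↦R e) (all-flat e))
  from : AtEveryEdge Reverses R × ¬ Flat R → IsP2Orientation R
  from (reverses , not-flat) =
    D ,
    Equivalence.from (isP2Config⇔ (Path m) D) (Equivalence.from (period-two⇔reversing D) reversing , moving) ,
    induced-heights R
    where
    D = heights R
    reversing : ∀ e → induced (step (Path m) D) e ≡ opposite (induced D e)
    reversing = unit-steps⇒reversing D (heights-unit-steps R)
                  (AtEveryEdge-cong {P = Reverses} (sym ∘ induced-heights R) reverses)
    moving : ¬ (step (Path m) D ≈C D)
    moving fixed = not-flat λ e → trans (sym (induced-heights R e)) (opposite-fixed⇒flat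
      (trans (sym (reversing e)) (cong₂ orient (fixed (inject₁ e)) (fixed (fsuc e)))))

-- Reversal at every edge and conditions (a)–(d)

agree-sym : ∀ {x y} → Agree x y → Agree y x
agree-sym (inj₁ (refl , refl)) = inj₁ (refl , refl)
agree-sym (inj₂ (refl , refl)) = inj₂ (refl , refl)

agree⇒¬disagree : ∀ {x y} → Agree x y → ¬ Disagree x y
agree⇒¬disagree (inj₁ (refl , refl)) (inj₁ (_ , ()))
agree⇒¬disagree (inj₁ (refl , refl)) (inj₂ (() , _))
agree⇒¬disagree (inj₂ (refl , refl)) (inj₁ (() , _))
agree⇒¬disagree (inj₂ (refl , refl)) (inj₂ (_ , ()))

disagree-agree : ∀ {x y z} → Disagree x y → Agree y z → Disagree x z
disagree-agree (inj₁ (refl , refl)) (inj₂ (refl , refl)) = inj₁ (refl , refl)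
disagree-agree (inj₂ (refl , refl)) (inj₁ (refl , refl)) = inj₂ (refl , refl)
disagree-agree (inj₁ (refl , refl)) (inj₁ (() , _))
disagree-agree (inj₂ (refl , refl)) (inj₂ (() , _))

¬agree-flatˡ : ∀ {x} → ¬ Agree flat x
¬agree-flatˡ (inj₁ (() , _))
¬agree-flatˡ (inj₂ (() , _))

¬agree-flatʳ : ∀ {x} → ¬ Agree x flat
¬agree-flatʳ (inj₁ (_ , ()))
¬agree-flatʳ (inj₂ (_ , ()))

¬disagree-flatˡ : ∀ {x} → ¬ Disagree flat x
¬disagree-flatˡ (inj₁ (() , _))
¬disagree-flatˡ (inj₂ (() , _))

¬disagree-flatʳ : ∀ {x} → ¬ Disagree x flat
¬disagree-flatʳ (inj₁ (_ , ()))
¬disagree-flatʳ (inj₂ (_ , ()))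

nonflat-disagree : ∀ {x y} → x ≢ flat → y ≢ flat → ¬ Agree x y → Disagree x y
nonflat-disagree {right} {left}  _ _ _ = inj₁ (refl , refl)
nonflat-disagree {left}  {right} _ _ _ = inj₂ (refl , refl)
nonflat-disagree {right} {right} _ _ ¬agree = ⊥-elim (¬agree (inj₁ (refl , refl)))
nonflat-disagree {left}  {left}  _ _ ¬agree = ⊥-elim (¬agree (inj₂ (refl , refl)))
nonflat-disagree {flat}  x≢flat _ _ = ⊥-elim (x≢flat refl)
nonflat-disagree {_} {flat} _ y≢flat _ = ⊥-elim (y≢flat refl)

-- Conditions (a)–(d) at a single edge q, with previous edge p and next edge r (flat if missing).
record Admissible (p q r : EdgeOri) : Set where
  field
    flat⇒flanks-disagree        : q ≡ flat → Disagree p r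
    agree-before⇒disagree-after : Agree p q → Disagree r q
    agree-after⇒disagree-before : Agree q r → Disagree p q

open Admissible

admissible⇒reverses : ∀ {p q r} → Admissible p q r → Reverses p q r
admissible⇒reverses {p} {flat} {r} adm with flat⇒flanks-disagree adm refl
... | inj₁ (refl , refl) = refl
... | inj₂ (refl , refl) = refl
admissible⇒reverses {right} {right} {r} adm with agree-before⇒disagree-after adm (inj₁ (refl , refl))
... | inj₂ (refl , refl) = refl
admissible⇒reverses {left} {right} {right} _ = refl
admissible⇒reverses {left} {right} {left}  _ = refl
admissible⇒reverses {left} {right} {flat}  _ = refl
admissible⇒reverses {flat} {right} {right} adm =
  ⊥-elim (¬disagree-flatˡ (agree-after⇒disagree-before adm (inj₁ (refl , refl))))
admissible⇒reverses {flat} {right} {left}  _ = refl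
admissible⇒reverses {flat} {right} {flat}  _ = refl
admissible⇒reverses {left} {left} {r} adm with agree-before⇒disagree-after adm (inj₂ (refl , refl))
... | inj₁ (refl , refl) = refl
admissible⇒reverses {right} {left} {right} _ = refl
admissible⇒reverses {right} {left} {left}  _ = refl
admissible⇒reverses {right} {left} {flat}  _ = refl
admissible⇒reverses {flat} {left} {left}   adm =
  ⊥-elim (¬disagree-flatˡ (agree-after⇒disagree-before adm (inj₂ (refl , refl))))
admissible⇒reverses {flat} {left} {right}  _ = refl
admissible⇒reverses {flat} {left} {flat}   _ = refl

reverses⇒admissible : ∀ {p q r} → Reverses p q r → ¬ (p ≡ flat × q ≡ flat) → Admissible p q r
reverses⇒admissible reverses ¬flat-pair = record
  { flat⇒flanks-disagree = flanks reverses ¬flat-pair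
  ; agree-before⇒disagree-after = before reverses
  ; agree-after⇒disagree-before = after reverses
  }
  where
  flanks : ∀ {p q r} → Reverses p q r → ¬ (p ≡ flat × q ≡ flat) → q ≡ flat → Disagree p r
  flanks {right} {r = left}  _  _   refl = inj₁ (refl , refl)
  flanks {left}  {r = right} _  _   refl = inj₂ (refl , refl)
  flanks {flat}              _  ¬ff refl = ⊥-elim (¬ff (refl , refl))
  flanks {right} {r = right} () _   refl
  flanks {right} {r = flat}  () _   refl
  flanks {left}  {r = left}  () _   refl
  flanks {left}  {r = flat}  () _   refl
  before : ∀ {p q r} → Reverses p q r → Agree p q → Disagree r q
  before {r = left}  _  (inj₁ (refl , refl)) = inj₂ (refl , refl)
  before {r = right} () (inj₁ (refl , refl))
  before {r = flat}  () (inj₁ (refl , refl))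
  before {r = right} _  (inj₂ (refl , refl)) = inj₁ (refl , refl)
  before {r = left}  () (inj₂ (refl , refl))
  before {r = flat}  () (inj₂ (refl , refl))
  after : ∀ {p q r} → Reverses p q r → Agree q r → Disagree p q
  after {p = left}  _  (inj₁ (refl , refl)) = inj₂ (refl , refl)
  after {p = right} () (inj₁ (refl , refl))
  after {p = flat}  () (inj₁ (refl , refl))
  after {p = right} _  (inj₂ (refl , refl)) = inj₁ (refl , refl)
  after {p = left}  () (inj₂ (refl , refl))
  after {p = flat}  () (inj₂ (refl , refl))

reverses-flat-pair : ∀ {r} → Reverses flat flat r → r ≡ flat
reverses-flat-pair {flat}  _ = refl
reverses-flat-pair {right} ()
reverses-flat-pair {left}  ()

admissible⇒¬flat-pair : ∀ {p q r} → Admissible p q r → ¬ (q ≡ flat × r ≡ flat)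
admissible⇒¬flat-pair adm (refl , refl) = ¬disagree-flatʳ (flat⇒flanks-disagree adm refl)

reverses-first-flat⇒flat : ∀ {m} {R : PathOrientation m} →
  AtEveryEdge Reverses R → pad R 1 ≡ flat → Flat R
reverses-first-flat⇒flat {m} {R} reverses first-flat i =
  trans (sym (pad-suc-toℕ R i)) (proj₂ (flat-pairs (toℕ i) (ℕ.<⇒≤ (toℕ<n i))))
  where
  flat-pairs : ∀ k → k ≤ m → pad R k ≡ flat × pad R (suc k) ≡ flat
  flat-pairs zero    _   = refl , first-flat
  flat-pairs (suc k) k<m with flat-pairs k (ℕ.<⇒≤ k<m)
  ... | pₖ , pₖ₊₁ = pₖ₊₁ , reverses-flat-pair
    (subst₂ (λ p q → Reverses p q (pad R (suc (suc k)))) pₖ pₖ₊₁ (at-position {P = Reverses} reverses k k<m))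

reverses⇒admissible-everywhere : ∀ {m} {R : PathOrientation m} →
  AtEveryEdge Reverses R → pad R 1 ≢ flat → AtEveryEdge Admissible R
reverses⇒admissible-everywhere {m} {R} reverses first-steep i = reverses⇒admissible (reverses i)
  λ (pᵢ , Rᵢ) → no-flat-pair (toℕ i) (ℕ.<⇒≤ (toℕ<n i)) (pᵢ , trans (pad-suc-toℕ R i) Rᵢ)
  where
  no-flat-pair : ∀ k → k ≤ m → ¬ (pad R k ≡ flat × pad R (suc k) ≡ flat)
  no-flat-pair zero    _   (_ , p₁) = first-steep p₁
  no-flat-pair (suc k) k<m = admissible⇒¬flat-pair
    (reverses⇒admissible (at-position {P = Reverses} reverses k k<m) (no-flat-pair k (ℕ.<⇒≤ k<m)))

reverses⇔admissible : ∀ {m} (R : PathOrientation (suc m)) →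
  (AtEveryEdge Reverses R × ¬ Flat R) ⇔ AtEveryEdge Admissible R
reverses⇔admissible R = mk⇔
  (λ (reverses , not-flat) →
     reverses⇒admissible-everywhere reverses (not-flat ∘ reverses-first-flat⇒flat reverses))
  (λ adm → admissible⇒reverses ∘ adm ,
           λ all-flat → ¬disagree-flatˡ (flat⇒flanks-disagree (adm fzero) (all-flat fzero)))

data Before {m} (R : PathOrientation m) (i : Fin m) : EdgeOri → Set where
  first : toℕ i ≡ 0 → Before R i flat
  edge  : ∀ h → Next h i → Before R i (R h)

data After {m} (R : PathOrientation m) (i : Fin m) : EdgeOri → Set where
  last : suc (toℕ i) ≡ m → After R i flat
  edge : ∀ l → Next i l → After R i (R l)

before : ∀ {m} (R : PathOrientation m) i → Before R i (pad R (toℕ i))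
before R fzero           = first refl
before R (fsuc fzero)    = edge fzero refl
before R (fsuc (fsuc i)) = shift (before (R ∘ fsuc) (fsuc i))
  where
  shift : ∀ {o} → Before (R ∘ fsuc) (fsuc i) o → Before R (fsuc (fsuc i)) o
  shift (first ())
  shift (edge h next) = edge (fsuc h) (cong suc next)

after : ∀ {m} (R : PathOrientation m) i → After R i (pad R (suc (suc (toℕ i))))
after {suc zero}    R fzero    = last refl
after {suc (suc m)} R fzero    = edge (fsuc fzero) refl
after {suc m}       R (fsuc i) = shift (after (R ∘ fsuc) i)
  where
  shift : ∀ {o} → After (R ∘ fsuc) i o → After R (fsuc i) o
  shift (last end)    = last (cong suc end)
  shift (edge l next) = edge (fsuc l) (cong suc next)

before-edge : ∀ {m} {R : PathOrientation m} {i h p} → Before R i p → Next h i → p ≡ R h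
before-edge (first i≡0)     next = ⊥-elim (ℕ.0≢1+n (trans (sym i≡0) next))
before-edge (edge h′ next′) next = cong _ (toℕ-injective (ℕ.suc-injective (trans (sym next′) next)))

after-edge : ∀ {m} {R : PathOrientation m} {i l r} → After R i r → Next i l → r ≡ R l
after-edge {l = l} (last end) next = ⊥-elim (ℕ.<-irrefl (trans next end) (toℕ<n l))
after-edge (edge l′ next′) next = cong _ (toℕ-injective (trans next′ (sym next)))

after-last : ∀ {m} {R : PathOrientation m} {i r} → After R i r → suc (toℕ i) ≡ m → r ≡ flat
after-last (last _)      _   = refl
after-last (edge l next) end = ⊥-elim (ℕ.<-irrefl (trans next end) (toℕ<n l))

before-disagree : ∀ {m} {R : PathOrientation m} {i p x} → Before R i p → Disagree p x →
  Σ[ h ∈ Fin m ] Next h i × Disagree (R h) x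
before-disagree (first _)     d = ⊥-elim (¬disagree-flatˡ d)
before-disagree (edge h next) d = h , next , d

after-disagree : ∀ {m} {R : PathOrientation m} {i r x} → After R i r → Disagree r x →
  Σ[ l ∈ Fin m ] Next i l × Disagree (R l) x
after-disagree (last _)      d = ⊥-elim (¬disagree-flatˡ d)
after-disagree (edge l next) d = l , next , d

conditions⇒admissible : ∀ {m} (R : PathOrientation m) → CondA R → CondB R → CondC R → CondD R →
  AtEveryEdge Admissible R
conditions⇒admissible R condA condB condC condD i = admissible (before R i) (after R i)
  where
  admissible : ∀ {p r} → Before R i p → After R i r → Admissible p (R i) r
  flat⇒flanks-disagree (admissible (first i≡0) _) Rᵢ = ⊥-elim (proj₁ (condB i Rᵢ) i≡0)
  flat⇒flanks-disagree (admissible (edge _ _) (last end)) Rᵢ = ⊥-elim (proj₂ (condB i Rᵢ) end)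
  flat⇒flanks-disagree (admissible (edge h h→i) (edge l i→l)) Rᵢ =
    nonflat-disagree (λ Rₕ → condA h i h→i (Rₕ , Rᵢ)) (λ Rₗ → condA i l i→l (Rᵢ , Rₗ)) (condC h i l h→i i→l Rᵢ)
  agree-before⇒disagree-after (admissible (first _) _) agree = ⊥-elim (¬agree-flatˡ agree)
  agree-before⇒disagree-after (admissible (edge h h→i) aft) agree with condD h i h→i agree
  ... | _ , l , _ , i→l , _ , dₗ =
    subst (λ r → Disagree r (R i)) (sym (after-edge aft i→l)) (disagree-agree dₗ agree)
  agree-after⇒disagree-before (admissible _ (last _)) agree = ⊥-elim (¬agree-flatʳ agree)
  agree-after⇒disagree-before (admissible bef (edge l i→l)) agree with condD i l i→l agree
  ... | h , _ , h→i , _ , dₕ , _ = subst (λ p → Disagree p (R i)) (sym (before-edge bef h→i)) dₕ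

admissible⇒conditions : ∀ {m} (R : PathOrientation m) → AtEveryEdge Admissible R →
  CondA R × CondB R × CondC R × CondD R
admissible⇒conditions R adm = condA , condB , condC , condD
  where
  flanks : ∀ i → R i ≡ flat → Disagree (pad R (toℕ i)) (pad R (suc (suc (toℕ i))))
  flanks i = flat⇒flanks-disagree (adm i)
  condA : CondA R
  condA i j i→j (Rᵢ , Rⱼ) =
    ¬disagree-flatʳ (subst (Disagree _) (trans (after-edge (after R i) i→j) Rⱼ) (flanks i Rᵢ))
  condB : CondB R
  condB i Rᵢ =
    (λ i≡0 → ¬disagree-flatˡ (subst (λ p → Disagree p (pad R (suc (suc (toℕ i))))) (cong (pad R) i≡0)
                                    (flanks i Rᵢ))) ,
    (λ end → ¬disagree-flatʳ (subst (Disagree _) (after-last (after R i) end) (flanks i Rᵢ)))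
  condC : CondC R
  condC h i j h→i i→j Rᵢ agree =
    agree⇒¬disagree agree
      (subst₂ Disagree (before-edge (before R i) h→i) (after-edge (after R i) i→j) (flanks i Rᵢ))
  condD : CondD R
  condD j k j→k agree
    with before-disagree (before R j) (agree-after⇒disagree-before (adm j)
           (subst (Agree (R j)) (sym (after-edge (after R j) j→k)) agree))
       | after-disagree (after R k) (agree-before⇒disagree-after (adm k)
           (subst (λ p → Agree p (R k)) (sym (before-edge (before R k) j→k)) agree))
  ... | h , h→j , dₕ | l , k→l , dₗ = h , l , h→j , k→l , dₕ , disagree-agree dₗ (agree-sym agree)

conditions⇔admissible : ∀ {m} (R : PathOrientation m) →
  (CondA R × CondB R × CondC R × CondD R) ⇔ AtEveryEdge Admissible R
conditions⇔admissible R =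
  mk⇔ (λ (a , b , c , d) → conditions⇒admissible R a b c d) (admissible⇒conditions R)

theorem2 : (m : ℕ) → 2 ≤ m → (R : PathOrientation m) →
    IsP2Orientation R ⇔ (CondA R × CondB R × CondC R × CondD R)
theorem2 (suc m) _ R = begin
  IsP2Orientation R                        ≈⟨ p2-orientation⇔ R ⟩
  (AtEveryEdge Reverses R × ¬ Flat R)      ≈⟨ reverses⇔admissible R ⟩
  AtEveryEdge Admissible R                 ≈⟨ conditions⇔admissible R ⟨
  (CondA R × CondB R × CondC R × CondD R)  ∎
  where open SetoidReasoning (⇔-setoid 0ℓ)
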